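{- Let $p$ be a prime and $\nu$ a partition of $n\ge1$. Then \[z_{\nu^p}\le n!\,p^{\frac{1-n}{p}}\,z_\nu.\]
   Context: For a partition $\nu$ with $m_j(\nu)$ parts equal to $j$, $z_\nu=\prod_j j^{m_j(\nu)}m_j(\nu)!$. $\nu^p$ denotes the cycle type of $g^p$ where $g$ is any permutation of cycle type $\nu$. -}

module Defs where

open import Data.Nat using (ℕ; zero; suc; _+_; _*_; _^_; _≤_)
open import Data.Nat.DivMod using (_/_)
open import Data.Nat.GCD using (gcd)
open import Data.Nat using (_!)
open import Data.Nat.ListAction using (sum; product)
open import Data.List using (List; []; _∷_; map; replicate; concatMap; applyUpTo)
open import Data.List.Relation.Unary.All using (All)
open import Relation.Binary.PropositionalEquality using (_≡_)
open import Relation.Nullary using (yes; no)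
open import Data.Nat using (_≟_)

-- A partition of n: a list of positive parts summing to n (order irrelevant).
record IsPartition (n : ℕ) (ν : List ℕ) : Set where
  field
    parts-pos : All (1 ≤_) ν
    parts-sum : sum ν ≡ n

mult : ℕ → List ℕ → ℕ
mult j [] = 0
mult j (x ∷ xs) with x ≟ j
... | yes _ = suc (mult j xs)
... | no  _ = mult j xs

-- z_ν = ∏_{j=1}^{|ν|} j^{m_j} m_j!   (parts are ≤ |ν| = sum ν)
z : List ℕ → ℕ
z ν = product (map (λ j → j ^ mult j ν * (mult j ν) !) (applyUpTo suc (sum ν)))

-- total division (divisor 0 gives 0; never used with divisor 0 below)
quot : ℕ → ℕ → ℕ
quot j zero    = 0
quot j (suc d) = j / suc d

-- ν^k: a j-cycle raised to the k-th power splits into gcd(j,k) cycles of length j/gcd(j,k)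
powerType : ℕ → List ℕ → List ℕ
powerType k ν = concatMap (λ j → replicate (gcd j k) (quot j (gcd j k))) ν

-- Add the parts of ν one at a time in increasing order. A new largest part x multiplies z_ν by
-- x (m_x(ν) + 1). If p ∤ x, the x-cycle stays an x-cycle of ν^p, and as the earlier parts are at
-- most x, m_x(ν^p) = m_x(ν); so z_{ν^p} grows by the same factor, while the extra p^x on the left
-- is absorbed because n!^p / p^(n - 1) is nondecreasing ((n + 1)^p ≥ p). If x = k p, the x-cycle
-- splits into p cycles of length k, multiplying z_{ν^p} by k^p (m + 1) ⋯ (m + p) with k m ≤ n for
-- m = m_k(ν^p); the p blocks of k consecutive factors that n! gains dominate this with p^(k - 1)
-- to spare, and x (m_x(ν) + 1) ≥ p supplies the last factor of p^k.

{-# OPTIONS --safe #-}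
module Submission where

open import Defs
open import Data.Nat using (ℕ; _*_; _^_; _∸_; _≤_)
open import Data.Nat.Primality using (Prime)
open import Data.Nat using (_!)
open import Data.List using (List)

open import Data.Nat.Properties
open import Algebra.Properties.CommutativeSemigroup *-commutativeSemigroup
  using (interchange; x∙yz≈y∙xz; xy∙z≈y∙xz)
import Relation.Binary.Construct.Flip.EqAndOrd as Flip
open import Data.List using ([]; _∷_; _++_; [_]; map; replicate; applyUpTo)
open import Data.List.Properties using (applyUpTo-∷ʳ; map-++)
open import Data.List.Relation.Binary.Permutation.Propositional as Perm using (_↭_; prep; swap; ↭-sym)
open import Data.List.Relation.Binary.Permutation.Propositional.Properties
  using (map⁺; ++⁺ˡ; shifts; All-resp-↭)
open import Data.List.Relation.Unary.All using (All; []; _∷_)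
open import Data.List.Relation.Unary.AllPairs using (AllPairs; []; _∷_)
open import Data.List.Relation.Unary.Linked.Properties using (Linked⇒AllPairs)
open import Data.List.Sort (Flip.decTotalOrder ≤-decTotalOrder) using (sort-↭; sort-↗)
open import Data.Nat using (zero; suc; _+_; _<_; _≥_; _≟_; z≤n; s≤s; z<s; s≤s⁻¹; NonZero)
open import Data.Nat.Divisibility using (_∣_; _∣?_; divides; ∣-antisym; ∣-refl)
open import Data.Nat.DivMod using (_/_; n/1≡n; m*n/n≡m; m/n≤m; m/n*n≤m)
open import Data.Nat.GCD using (gcd; gcd[m,n]∣m; gcd[m,n]∣n; gcd-greatest)
open import Data.Nat.ListAction using (sum; product)
open import Data.Nat.ListAction.Properties using (sum-++; sum-↭; product-++)
open import Data.Nat.Primality using (prime⇒irreducible; prime⇒nonZero)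
open import Data.Nat.Tactic.RingSolver using (solve-∀)
open import Data.Sum using (inj₁; inj₂)
open import Function using (_∘_)
open import Relation.Binary.PropositionalEquality
  using (_≡_; _≢_; refl; sym; trans; cong; cong₂; subst; module ≡-Reasoning)
open import Relation.Nullary using (¬_; yes; no; contradiction)

^-distribʳ-* : ∀ m n o → (m * n) ^ o ≡ m ^ o * n ^ o
^-distribʳ-* m n zero    = refl
^-distribʳ-* m n (suc o) =
  trans (cong (m * n *_) (^-distribʳ-* m n o)) (interchange m n (m ^ o) (n ^ o))

n<2^n : ∀ n → n < 2 ^ n
n<2^n zero    = z<s
n<2^n (suc n) = +-mono-≤ (m^n>0 2 n) (≤-trans (n<2^n n) (m≤m+n (2 ^ n) 0))

p^[1+n∸1]≤[1+n]^p*p^[n∸1] : ∀ p n → p ^ (suc n ∸ 1) ≤ suc n ^ p * p ^ (n ∸ 1)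
p^[1+n∸1]≤[1+n]^p*p^[n∸1] p zero    = ≤-reflexive (sym (cong (_* 1) (^-zeroˡ p)))
p^[1+n∸1]≤[1+n]^p*p^[n∸1] p (suc n) =
  *-monoˡ-≤ (p ^ n) (≤-trans (<⇒≤ (n<2^n p)) (^-monoˡ-≤ p (s≤s (s≤s z≤n))))

m!^p*p^[d+m∸1]≤[d+m]!^p*p^[m∸1] : ∀ p d m →
  (m !) ^ p * p ^ (d + m ∸ 1) ≤ ((d + m) !) ^ p * p ^ (m ∸ 1)
m!^p*p^[d+m∸1]≤[d+m]!^p*p^[m∸1] p zero    m = ≤-refl
m!^p*p^[d+m∸1]≤[d+m]!^p*p^[m∸1] p (suc d) m = begin
  (m !) ^ p * p ^ (suc n ∸ 1)               ≤⟨ *-monoʳ-≤ ((m !) ^ p) (p^[1+n∸1]≤[1+n]^p*p^[n∸1] p n) ⟩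
  (m !) ^ p * (suc n ^ p * p ^ (n ∸ 1))     ≡⟨ x∙yz≈y∙xz ((m !) ^ p) (suc n ^ p) (p ^ (n ∸ 1)) ⟩
  suc n ^ p * ((m !) ^ p * p ^ (n ∸ 1))     ≤⟨ *-monoʳ-≤ (suc n ^ p) (m!^p*p^[d+m∸1]≤[d+m]!^p*p^[m∸1] p d m) ⟩
  suc n ^ p * ((n !) ^ p * p ^ (m ∸ 1))     ≡⟨ *-assoc (suc n ^ p) ((n !) ^ p) (p ^ (m ∸ 1)) ⟨
  suc n ^ p * (n !) ^ p * p ^ (m ∸ 1)       ≡⟨ cong (_* p ^ (m ∸ 1)) (^-distribʳ-* (suc n) (n !) p) ⟨
  (suc n !) ^ p * p ^ (m ∸ 1)               ∎
  where
  open ≤-Reasoning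
  n = d + m

m+n∸1≤m+[n∸1] : ∀ m n → m + n ∸ 1 ≤ m + (n ∸ 1)
m+n∸1≤m+[n∸1] m zero    = m∸n≤m (m + 0) 1
m+n∸1≤m+[n∸1] m (suc n) = ≤-reflexive (cong (_∸ 1) (+-suc m n))

n!*[1+n]^k≤[n+k]! : ∀ n k → n ! * suc n ^ k ≤ (n + k) !
n!*[1+n]^k≤[n+k]! n zero    = ≤-reflexive (trans (*-identityʳ (n !)) (cong _! (sym (+-identityʳ n))))
n!*[1+n]^k≤[n+k]! n (suc k) = begin
  n ! * (suc n * suc n ^ k)   ≡⟨ x∙yz≈y∙xz (n !) (suc n) (suc n ^ k) ⟩
  suc n * (n ! * suc n ^ k)   ≤⟨ *-mono-≤ (s≤s (m≤m+n n k)) (n!*[1+n]^k≤[n+k]! n k) ⟩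
  suc (n + k) * (n + k) !     ≡⟨ cong _! (+-suc n k) ⟨
  (n + suc k) !               ∎
  where open ≤-Reasoning

risingFactorial : ℕ → ℕ → ℕ
risingFactorial x zero    = 1
risingFactorial x (suc c) = (x + c) * risingFactorial x c

-- With a = n + q k, the block (a + 1) ⋯ (a + k) of (n + (1 + q) k)! is at least (a + k) (a + 1) ^ j:
-- its last factor pays for k (m + 1 + q) and the others for t ^ j.
risingFactorial-bound-suc : ∀ j q m n t → suc j * m ≤ n → t ≤ suc (n + q * suc j) →
  suc j ^ q * risingFactorial (suc m) q * n ! ≤ (n + q * suc j) ! →
  suc j ^ suc q * risingFactorial (suc m) (suc q) * n ! * t ^ j ≤ (n + suc q * suc j) !
risingFactorial-bound-suc j q m n t km≤n t≤1+a bound = begin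
  k ^ suc q * risingFactorial (suc m) (suc q) * n ! * t ^ j
    ≡⟨ regroup k (k ^ q) (suc m + q) (risingFactorial (suc m) q) (n !) (t ^ j) ⟩
  k * (suc m + q) * (k ^ q * risingFactorial (suc m) q * n ! * t ^ j)
    ≤⟨ *-mono-≤ k[1+m+q]≤a+k (*-mono-≤ bound (^-monoˡ-≤ j t≤1+a)) ⟩
  (n + suc q * k) * (a ! * suc a ^ j)
    ≤⟨ *-monoʳ-≤ (n + suc q * k) (n!*[1+n]^k≤[n+k]! a j) ⟩
  (n + suc q * k) * (a + j) !
    ≡⟨ cong (_* (a + j) !) 1+a+j≡a+k ⟨
  suc (a + j) !
    ≡⟨ cong _! 1+a+j≡a+k ⟩
  (n + suc q * k) !
    ∎
  where
  open ≤-Reasoning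
  k = suc j
  a = n + q * k
  regroup : ∀ k K s R F T → k * K * (s * R) * F * T ≡ k * s * (K * R * F * T)
  regroup = solve-∀
  shift : ∀ n q j → suc (n + q * suc j + j) ≡ n + suc q * suc j
  shift = solve-∀
  expand : ∀ k m q → k * (suc m + q) ≡ k * m + suc q * k
  expand = solve-∀
  1+a+j≡a+k : suc (a + j) ≡ n + suc q * k
  1+a+j≡a+k = shift n q j
  k[1+m+q]≤a+k : k * (suc m + q) ≤ n + suc q * k
  k[1+m+q]≤a+k = ≤-trans (≤-reflexive (expand k m q)) (+-monoˡ-≤ (suc q * k) km≤n)

risingFactorial-bound : ∀ j q m n → suc j * m ≤ n →
  suc j ^ q * risingFactorial (suc m) q * n ! ≤ (n + q * suc j) !
risingFactorial-bound j zero    m n _    =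
  ≤-reflexive (trans (+-identityʳ (n !)) (cong _! (sym (+-identityʳ n))))
risingFactorial-bound j (suc q) m n km≤n = begin
  B                 ≡⟨ *-identityʳ B ⟨
  B * 1             ≡⟨ cong (B *_) (^-zeroˡ j) ⟨
  B * 1 ^ j         ≤⟨ risingFactorial-bound-suc j q m n 1 km≤n (s≤s z≤n)
                         (risingFactorial-bound j q m n km≤n) ⟩
  (n + suc q * suc j) ! ∎
  where
  open ≤-Reasoning
  B = suc j ^ suc q * risingFactorial (suc m) (suc q) * n !

∏₁ : (ℕ → ℕ) → ℕ → ℕ
∏₁ f N = product (map f (applyUpTo suc N))

∏₁-suc : ∀ f N → ∏₁ f (suc N) ≡ ∏₁ f N * f (suc N)
∏₁-suc f N = begin
  product (map f (applyUpTo suc (suc N)))               ≡⟨ cong (product ∘ map f) (applyUpTo-∷ʳ suc N) ⟨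
  product (map f (applyUpTo suc N ++ [ suc N ]))        ≡⟨ cong product (map-++ f (applyUpTo suc N) [ suc N ]) ⟩
  product (map f (applyUpTo suc N) ++ [ f (suc N) ])    ≡⟨ product-++ (map f (applyUpTo suc N)) [ f (suc N) ] ⟩
  ∏₁ f N * (f (suc N) * 1)                              ≡⟨ cong (∏₁ f N *_) (*-identityʳ (f (suc N))) ⟩
  ∏₁ f N * f (suc N)                                    ∎
  where open ≡-Reasoning

∏₁-cong : ∀ {f h} N → (∀ {j} → j ≤ N → f j ≡ h j) → ∏₁ f N ≡ ∏₁ h N
∏₁-cong         zero    _   = refl
∏₁-cong {f} {h} (suc N) f≗h = begin
  ∏₁ f (suc N)          ≡⟨ ∏₁-suc f N ⟩
  ∏₁ f N * f (suc N)    ≡⟨ cong₂ _*_ (∏₁-cong N (f≗h ∘ m≤n⇒m≤1+n)) (f≗h ≤-refl) ⟩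
  ∏₁ h N * h (suc N)    ≡⟨ ∏₁-suc h N ⟨
  ∏₁ h (suc N)          ∎
  where open ≡-Reasoning

∏₁-extend : ∀ {f N} d → (∀ {j} → N < j → f j ≡ 1) → ∏₁ f (d + N) ≡ ∏₁ f N
∏₁-extend         zero    _   = refl
∏₁-extend {f} {N} (suc d) f≡1 = begin
  ∏₁ f (suc (d + N))                ≡⟨ ∏₁-suc f (d + N) ⟩
  ∏₁ f (d + N) * f (suc (d + N))    ≡⟨ cong₂ _*_ (∏₁-extend d f≡1) (f≡1 (s≤s (m≤n+m N d))) ⟩
  ∏₁ f N * 1                        ≡⟨ *-identityʳ (∏₁ f N) ⟩
  ∏₁ f N                            ∎
  where open ≡-Reasoning

∏₁-update : ∀ {f h x} N c → 1 ≤ x → x ≤ N → f x ≡ c * h x → (∀ {j} → j ≢ x → f j ≡ h j) →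
  ∏₁ f N ≡ c * ∏₁ h N
∏₁-update zero _ 1≤x x≤0 _ _ = contradiction (≤-trans 1≤x x≤0) λ ()
∏₁-update {f} {h} {x} (suc N) c 1≤x x≤1+N fx f≗h with x ≟ suc N
... | yes refl = begin
  ∏₁ f (suc N)          ≡⟨ ∏₁-suc f N ⟩
  ∏₁ f N * f x          ≡⟨ cong₂ _*_ (∏₁-cong N (λ j≤N → f≗h (<⇒≢ (s≤s j≤N)))) fx ⟩
  ∏₁ h N * (c * h x)    ≡⟨ x∙yz≈y∙xz (∏₁ h N) c (h x) ⟩
  c * (∏₁ h N * h x)    ≡⟨ cong (c *_) (∏₁-suc h N) ⟨
  c * ∏₁ h (suc N)      ∎
  where open ≡-Reasoning
... | no x≢1+N = begin
  ∏₁ f (suc N)              ≡⟨ ∏₁-suc f N ⟩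
  ∏₁ f N * f (suc N)        ≡⟨ cong₂ _*_ (∏₁-update N c 1≤x (s≤s⁻¹ (≤∧≢⇒< x≤1+N x≢1+N)) fx f≗h)
                                         (f≗h (x≢1+N ∘ sym)) ⟩
  c * ∏₁ h N * h (suc N)    ≡⟨ *-assoc c (∏₁ h N) (h (suc N)) ⟩
  c * (∏₁ h N * h (suc N))  ≡⟨ cong (c *_) (∏₁-suc h N) ⟨
  c * ∏₁ h (suc N)          ∎
  where open ≡-Reasoning

mult-∷-≡ : ∀ x ν → mult x (x ∷ ν) ≡ suc (mult x ν)
mult-∷-≡ x ν with x ≟ x
... | yes _   = refl
... | no x≢x = contradiction refl x≢x

mult-∷-≢ : ∀ {x j} ν → x ≢ j → mult j (x ∷ ν) ≡ mult j ν
mult-∷-≢ {x} {j} ν x≢j with x ≟ j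
... | yes x≡j = contradiction x≡j x≢j
... | no _    = refl

mult-++ : ∀ j μ ν → mult j (μ ++ ν) ≡ mult j μ + mult j ν
mult-++ j []      ν = refl
mult-++ j (x ∷ μ) ν with x ≟ j
... | yes _ = cong suc (mult-++ j μ ν)
... | no _  = mult-++ j μ ν

mult-replicate-≡ : ∀ k c → mult k (replicate c k) ≡ c
mult-replicate-≡ k zero    = refl
mult-replicate-≡ k (suc c) = trans (mult-∷-≡ k (replicate c k)) (cong suc (mult-replicate-≡ k c))

mult-replicate-≢ : ∀ {v j} c → v ≢ j → mult j (replicate c v) ≡ 0
mult-replicate-≢     zero    _   = refl
mult-replicate-≢ {v} (suc c) v≢j = trans (mult-∷-≢ (replicate c v) v≢j) (mult-replicate-≢ c v≢j)

mult≡sum-map : ∀ j ν → mult j ν ≡ sum (map (λ x → mult j [ x ]) ν)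
mult≡sum-map j []      = refl
mult≡sum-map j (x ∷ ν) = trans (mult-++ j [ x ] ν) (cong (mult j [ x ] +_) (mult≡sum-map j ν))

mult-↭ : ∀ j {μ ν} → μ ↭ ν → mult j μ ≡ mult j ν
mult-↭ j {μ} {ν} μ↭ν = begin
  mult j μ                            ≡⟨ mult≡sum-map j μ ⟩
  sum (map (λ x → mult j [ x ]) μ)    ≡⟨ sum-↭ (map⁺ (λ x → mult j [ x ]) μ↭ν) ⟩
  sum (map (λ x → mult j [ x ]) ν)    ≡⟨ mult≡sum-map j ν ⟨
  mult j ν                            ∎
  where open ≡-Reasoning

*-mult≤sum : ∀ j ν → j * mult j ν ≤ sum ν
*-mult≤sum j []      = ≤-reflexive (*-zeroʳ j)
*-mult≤sum j (x ∷ ν) with x ≟ j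
... | yes refl = ≤-trans (≤-reflexive (*-suc x (mult x ν))) (+-monoʳ-≤ x (*-mult≤sum x ν))
... | no _     = ≤-trans (*-mult≤sum j ν) (m≤n+m (sum ν) x)

sum<⇒mult≡0 : ∀ {j} ν → sum ν < j → mult j ν ≡ 0
sum<⇒mult≡0 {j} ν sum<j with mult j ν | *-mult≤sum j ν
... | zero  | _        = refl
... | suc m | jm≤sum = contradiction (≤-trans (m≤m*n j (suc m)) jm≤sum) (<⇒≱ sum<j)

-- z ν is definitionally ∏₁ (multFactor ν) (sum ν).
multFactor : List ℕ → ℕ → ℕ
multFactor ν j = j ^ mult j ν * (mult j ν) !

multFactor-∷-≡ : ∀ x ν → multFactor (x ∷ ν) x ≡ x * suc (mult x ν) * multFactor ν x
multFactor-∷-≡ x ν =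
  trans (cong (λ m → x ^ m * m !) (mult-∷-≡ x ν)) (regroup x (mult x ν) (x ^ mult x ν) (mult x ν !))
  where
  regroup : ∀ x m X M → x * X * (suc m * M) ≡ x * suc m * (X * M)
  regroup = solve-∀

multFactor-∷-≢ : ∀ {x j} ν → x ≢ j → multFactor (x ∷ ν) j ≡ multFactor ν j
multFactor-∷-≢ {j = j} ν x≢j = cong (λ m → j ^ m * m !) (mult-∷-≢ ν x≢j)

sum<⇒multFactor≡1 : ∀ {j} ν → sum ν < j → multFactor ν j ≡ 1
sum<⇒multFactor≡1 {j} ν sum<j = cong (λ m → j ^ m * m !) (sum<⇒mult≡0 ν sum<j)

z-∷ : ∀ {x} ν → 1 ≤ x → z (x ∷ ν) ≡ x * suc (mult x ν) * z ν
z-∷ {x} ν 1≤x = begin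
  ∏₁ (multFactor (x ∷ ν)) (x + sum ν)   ≡⟨ ∏₁-update (x + sum ν) c 1≤x (m≤m+n x (sum ν)) (multFactor-∷-≡ x ν)
                                                     (λ j≢x → multFactor-∷-≢ ν (j≢x ∘ sym)) ⟩
  c * ∏₁ (multFactor ν) (x + sum ν)     ≡⟨ cong (c *_) (∏₁-extend x (sum<⇒multFactor≡1 ν)) ⟩
  c * z ν                               ∎
  where
  open ≡-Reasoning
  c = x * suc (mult x ν)

z-↭ : ∀ {μ ν} → μ ↭ ν → z μ ≡ z ν
z-↭ {μ} {ν} μ↭ν = begin
  ∏₁ (multFactor μ) (sum μ)   ≡⟨ ∏₁-cong (sum μ) (λ {j} _ → cong (λ m → j ^ m * m !) (mult-↭ j μ↭ν)) ⟩
  ∏₁ (multFactor ν) (sum μ)   ≡⟨ cong (∏₁ (multFactor ν)) (sum-↭ μ↭ν) ⟩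
  ∏₁ (multFactor ν) (sum ν)   ∎
  where open ≡-Reasoning

z-replicate-++ : ∀ {k} c μ → 1 ≤ k →
  z (replicate c k ++ μ) ≡ k ^ c * risingFactorial (suc (mult k μ)) c * z μ
z-replicate-++     zero    μ _   = sym (+-identityʳ (z μ))
z-replicate-++ {k} (suc c) μ 1≤k = begin
  z (k ∷ replicate c k ++ μ)
    ≡⟨ z-∷ (replicate c k ++ μ) 1≤k ⟩
  k * suc (mult k (replicate c k ++ μ)) * z (replicate c k ++ μ)
    ≡⟨ cong₂ (λ t u → k * suc t * u) mult-eq (z-replicate-++ c μ 1≤k) ⟩
  k * suc (c + m) * (k ^ c * risingFactorial (suc m) c * z μ)
    ≡⟨ regroup k c m (k ^ c) (risingFactorial (suc m) c) (z μ) ⟩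
  k ^ suc c * risingFactorial (suc m) (suc c) * z μ
    ∎
  where
  open ≡-Reasoning
  m = mult k μ
  mult-eq : mult k (replicate c k ++ μ) ≡ c + m
  mult-eq = trans (mult-++ k (replicate c k) μ) (cong (_+ m) (mult-replicate-≡ k c))
  regroup : ∀ k c m K R Z → k * suc (c + m) * (K * R * Z) ≡ k * K * ((suc m + c) * R) * Z
  regroup = solve-∀

-- Cycle type of a p-th power

powerTypeOfCycle : ℕ → ℕ → List ℕ
powerTypeOfCycle p j = replicate (gcd j p) (quot j (gcd j p))

m∣n⇒gcd[n,m]≡m : ∀ {m n} → m ∣ n → gcd n m ≡ m
m∣n⇒gcd[n,m]≡m {m} {n} m∣n = ∣-antisym (gcd[m,n]∣n n m) (gcd-greatest m∣n ∣-refl)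

prime∤n⇒gcd[n,p]≡1 : ∀ {p n} → Prime p → ¬ p ∣ n → gcd n p ≡ 1
prime∤n⇒gcd[n,p]≡1 {p} {n} p-prime p∤n with prime⇒irreducible p-prime (gcd[m,n]∣n n p)
... | inj₁ gcd≡1 = gcd≡1
... | inj₂ gcd≡p = contradiction (subst (_∣ n) gcd≡p (gcd[m,n]∣m n p)) p∤n

powerTypeOfCycle-∤ : ∀ {p j} → Prime p → ¬ p ∣ j → powerTypeOfCycle p j ≡ [ j ]
powerTypeOfCycle-∤ {p} {j} p-prime p∤j =
  trans (cong (λ d → replicate d (quot j d)) (prime∤n⇒gcd[n,p]≡1 p-prime p∤j)) (cong [_] (n/1≡n j))

powerTypeOfCycle-∣ : ∀ {p j} .{{_ : NonZero p}} → p ∣ j → powerTypeOfCycle p j ≡ replicate p (j / p)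
powerTypeOfCycle-∣ {suc q} {j} p∣j = cong (λ d → replicate d (quot j d)) (m∣n⇒gcd[n,m]≡m p∣j)

sum-powerTypeOfCycle≤ : ∀ p j → sum (powerTypeOfCycle p j) ≤ j
sum-powerTypeOfCycle≤ p j = ≤-trans (≤-reflexive (sum-replicate (gcd j p))) (d*quot≤ (gcd j p))
  where
  sum-replicate : ∀ c {v} → sum (replicate c v) ≡ c * v
  sum-replicate zero    = refl
  sum-replicate (suc c) = cong (_ +_) (sum-replicate c)
  d*quot≤ : ∀ d → d * quot j d ≤ j
  d*quot≤ zero    = z≤n
  d*quot≤ (suc d) = ≤-trans (≤-reflexive (*-comm (suc d) (j / suc d))) (m/n*n≤m j (suc d))

sum-powerType≤ : ∀ p ν → sum (powerType p ν) ≤ sum ν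
sum-powerType≤ p []      = z≤n
sum-powerType≤ p (y ∷ ν) = begin
  sum (powerTypeOfCycle p y ++ powerType p ν)           ≡⟨ sum-++ (powerTypeOfCycle p y) (powerType p ν) ⟩
  sum (powerTypeOfCycle p y) + sum (powerType p ν)      ≤⟨ +-mono-≤ (sum-powerTypeOfCycle≤ p y) (sum-powerType≤ p ν) ⟩
  y + sum ν                                             ∎
  where open ≤-Reasoning

powerType-↭ : ∀ p {μ ν} → μ ↭ ν → powerType p μ ↭ powerType p ν
powerType-↭ p Perm.refl             = Perm.refl
powerType-↭ p (prep x μ↭ν)          = ++⁺ˡ (powerTypeOfCycle p x) (powerType-↭ p μ↭ν)
powerType-↭ p (swap x y μ↭ν)        = Perm.trans
  (++⁺ˡ (powerTypeOfCycle p x) (++⁺ˡ (powerTypeOfCycle p y) (powerType-↭ p μ↭ν)))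
  (shifts (powerTypeOfCycle p x) (powerTypeOfCycle p y))
powerType-↭ p (Perm.trans μ↭ν ν↭ρ)  = Perm.trans (powerType-↭ p μ↭ν) (powerType-↭ p ν↭ρ)

mult-powerTypeOfCycle : ∀ {p x y} → Prime p → ¬ p ∣ x → y ≤ x →
  mult x (powerTypeOfCycle p y) ≡ mult x [ y ]
mult-powerTypeOfCycle {p} {x} {y} p-prime p∤x y≤x with p ∣? y
... | no p∤y  = cong (mult x) (powerTypeOfCycle-∤ p-prime p∤y)
... | yes p∣y = begin
  mult x (powerTypeOfCycle p y)     ≡⟨ cong (mult x) (powerTypeOfCycle-∣ p∣y) ⟩
  mult x (replicate p (y / p))      ≡⟨ mult-replicate-≢ p y/p≢x ⟩
  0                                 ≡⟨ mult-replicate-≢ 1 y≢x ⟨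
  mult x [ y ]                      ∎
  where
  open ≡-Reasoning
  instance
    p≢0 : NonZero p
    p≢0 = prime⇒nonZero p-prime
  y≢x : y ≢ x
  y≢x refl = p∤x p∣y
  y/p≢x : y / p ≢ x
  y/p≢x y/p≡x = y≢x (≤-antisym y≤x (subst (_≤ y) y/p≡x (m/n≤m y p)))

mult-powerType : ∀ {p x ν} → Prime p → ¬ p ∣ x → All (_≤ x) ν → mult x (powerType p ν) ≡ mult x ν
mult-powerType _ _ [] = refl
mult-powerType {p} {x} {y ∷ ν} p-prime p∤x (y≤x ∷ ν≤x) = begin
  mult x (powerTypeOfCycle p y ++ powerType p ν)          ≡⟨ mult-++ x (powerTypeOfCycle p y) (powerType p ν) ⟩
  mult x (powerTypeOfCycle p y) + mult x (powerType p ν)  ≡⟨ cong₂ _+_ (mult-powerTypeOfCycle p-prime p∤x y≤x)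
                                                                      (mult-powerType p-prime p∤x ν≤x) ⟩
  mult x [ y ] + mult x ν                                 ≡⟨ mult-++ x [ y ] ν ⟨
  mult x (y ∷ ν)                                          ∎
  where open ≡-Reasoning

-- The inequality, one part at a time

Bound : ℕ → List ℕ → Set
Bound p ν = z (powerType p ν) ^ p * p ^ (sum ν ∸ 1) ≤ (sum ν ! * z ν) ^ p

bound-[] : ∀ p → Bound p []
bound-[] p = ≤-reflexive (*-identityʳ (1 ^ p))

bound-↭ : ∀ {p μ ν} → μ ↭ ν → Bound p μ → Bound p ν
bound-↭ {p} {μ} {ν} μ↭ν bound = begin
  z (powerType p ν) ^ p * p ^ (sum ν ∸ 1)
    ≡⟨ cong₂ (λ Z s → Z ^ p * p ^ (s ∸ 1)) (z-↭ (powerType-↭ p μ↭ν)) (sum-↭ μ↭ν) ⟨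
  z (powerType p μ) ^ p * p ^ (sum μ ∸ 1)
    ≤⟨ bound ⟩
  (sum μ ! * z μ) ^ p
    ≡⟨ cong₂ (λ s ζ → (s ! * ζ) ^ p) (sum-↭ μ↭ν) (z-↭ μ↭ν) ⟩
  (sum ν ! * z ν) ^ p
    ∎
  where open ≤-Reasoning

-- Z = a Z₀ and ζ = b ζ₀ are z(ν^p) and z(ν) after adding a part; F and P stand for n! and p^(n ∸ 1).
bound-extend : ∀ p {a b Z₀ ζ₀ F₀ F₁ P₀ P₁ Z ζ} .{{_ : NonZero P₀}} → Z ≡ a * Z₀ → ζ ≡ b * ζ₀ →
  Z₀ ^ p * P₀ ≤ (F₀ * ζ₀) ^ p → a ^ p * (F₀ ^ p * P₁) ≤ b ^ p * (F₁ ^ p * P₀) →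
  Z ^ p * P₁ ≤ (F₁ * ζ) ^ p
bound-extend p {a} {b} {Z₀} {ζ₀} {F₀} {F₁} {P₀} {P₁} refl refl old step =
  *-cancelʳ-≤ ((a * Z₀) ^ p * P₁) ((F₁ * (b * ζ₀)) ^ p) P₀ (begin
    (a * Z₀) ^ p * P₁ * P₀               ≡⟨ cong (λ t → t * P₁ * P₀) (^-distribʳ-* a Z₀ p) ⟩
    a ^ p * Z₀ ^ p * P₁ * P₀             ≡⟨ regroup₁ (a ^ p) (Z₀ ^ p) P₁ P₀ ⟩
    a ^ p * P₁ * (Z₀ ^ p * P₀)           ≤⟨ *-monoʳ-≤ (a ^ p * P₁) old ⟩
    a ^ p * P₁ * (F₀ * ζ₀) ^ p           ≡⟨ cong (a ^ p * P₁ *_) (^-distribʳ-* F₀ ζ₀ p) ⟩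
    a ^ p * P₁ * (F₀ ^ p * ζ₀ ^ p)       ≡⟨ regroup₂ (a ^ p) P₁ (F₀ ^ p) (ζ₀ ^ p) ⟩
    ζ₀ ^ p * (a ^ p * (F₀ ^ p * P₁))     ≤⟨ *-monoʳ-≤ (ζ₀ ^ p) step ⟩
    ζ₀ ^ p * (b ^ p * (F₁ ^ p * P₀))     ≡⟨ regroup₃ (ζ₀ ^ p) (b ^ p) (F₁ ^ p) P₀ ⟩
    F₁ ^ p * (b ^ p * ζ₀ ^ p) * P₀       ≡⟨ cong (λ t → F₁ ^ p * t * P₀) (^-distribʳ-* b ζ₀ p) ⟨
    F₁ ^ p * (b * ζ₀) ^ p * P₀           ≡⟨ cong (_* P₀) (^-distribʳ-* F₁ (b * ζ₀) p) ⟨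
    (F₁ * (b * ζ₀)) ^ p * P₀             ∎)
  where
  open ≤-Reasoning
  regroup₁ : ∀ A Z P Q → A * Z * P * Q ≡ A * P * (Z * Q)
  regroup₁ = solve-∀
  regroup₂ : ∀ A P F Z → A * P * (F * Z) ≡ Z * (A * (F * P))
  regroup₂ = solve-∀
  regroup₃ : ∀ Z B F Q → Z * (B * (F * Q)) ≡ F * (B * Z) * Q
  regroup₃ = solve-∀

bound-∷-∤ : ∀ {p x ν} → Prime p → ¬ p ∣ x → 1 ≤ x → All (_≤ x) ν → Bound p ν → Bound p (x ∷ ν)
bound-∷-∤ {p} {x} {ν} p-prime p∤x 1≤x ν≤x bound =
  bound-extend p zμ-eq (z-∷ ν 1≤x) bound
    (*-monoʳ-≤ (c ^ p) (m!^p*p^[d+m∸1]≤[d+m]!^p*p^[m∸1] p x (sum ν)))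
  where
  instance
    p^n≢0 : NonZero (p ^ (sum ν ∸ 1))
    p^n≢0 = m^n≢0 p (sum ν ∸ 1) {{prime⇒nonZero p-prime}}
  μ = powerType p ν
  c = x * suc (mult x ν)
  zμ-eq : z (powerType p (x ∷ ν)) ≡ c * z μ
  zμ-eq = begin
    z (powerTypeOfCycle p x ++ μ)     ≡⟨ cong (λ l → z (l ++ μ)) (powerTypeOfCycle-∤ p-prime p∤x) ⟩
    z (x ∷ μ)                         ≡⟨ z-∷ μ 1≤x ⟩
    x * suc (mult x μ) * z μ          ≡⟨ cong (λ m → x * suc m * z μ) (mult-powerType p-prime p∤x ν≤x) ⟩
    c * z μ                           ∎
    where open ≡-Reasoning

p^[kp+n∸1]-absorb : ∀ p k n {A F G b} .{{_ : NonZero p}} → A * F * p ^ k ≤ G * b →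
  A ^ p * (F ^ p * p ^ (k * p + n ∸ 1)) ≤ b ^ p * (G ^ p * p ^ (n ∸ 1))
p^[kp+n∸1]-absorb p k n {A} {F} {G} {b} AFp^k≤Gb = begin
  A ^ p * (F ^ p * p ^ (k * p + n ∸ 1))
    ≤⟨ *-monoʳ-≤ (A ^ p) (*-monoʳ-≤ (F ^ p) (^-monoʳ-≤ p (m+n∸1≤m+[n∸1] (k * p) n))) ⟩
  A ^ p * (F ^ p * p ^ (k * p + (n ∸ 1)))
    ≡⟨ cong (λ t → A ^ p * (F ^ p * t)) p^[kp+e]≡ ⟩
  A ^ p * (F ^ p * ((p ^ k) ^ p * p ^ (n ∸ 1)))
    ≡⟨ regroup (A ^ p) (F ^ p) ((p ^ k) ^ p) (p ^ (n ∸ 1)) ⟩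
  A ^ p * F ^ p * (p ^ k) ^ p * p ^ (n ∸ 1)
    ≡⟨ cong (_* p ^ (n ∸ 1)) ^-distribʳ-*₃ ⟨
  (A * F * p ^ k) ^ p * p ^ (n ∸ 1)
    ≤⟨ *-monoˡ-≤ (p ^ (n ∸ 1)) (^-monoˡ-≤ p AFp^k≤Gb) ⟩
  (G * b) ^ p * p ^ (n ∸ 1)
    ≡⟨ cong (_* p ^ (n ∸ 1)) (^-distribʳ-* G b p) ⟩
  G ^ p * b ^ p * p ^ (n ∸ 1)
    ≡⟨ xy∙z≈y∙xz (G ^ p) (b ^ p) (p ^ (n ∸ 1)) ⟩
  b ^ p * (G ^ p * p ^ (n ∸ 1))
    ∎
  where
  open ≤-Reasoning
  p^[kp+e]≡ : p ^ (k * p + (n ∸ 1)) ≡ (p ^ k) ^ p * p ^ (n ∸ 1)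
  p^[kp+e]≡ = trans (^-distribˡ-+-* p (k * p) (n ∸ 1)) (cong (_* p ^ (n ∸ 1)) (sym (^-*-assoc p k p)))
  ^-distribʳ-*₃ : (A * F * p ^ k) ^ p ≡ A ^ p * F ^ p * (p ^ k) ^ p
  ^-distribʳ-*₃ = trans (^-distribʳ-* (A * F) (p ^ k) p) (cong (_* (p ^ k) ^ p) (^-distribʳ-* A F p))
  regroup : ∀ A F K E → A * (F * (K * E)) ≡ A * F * K * E
  regroup = solve-∀

bound-∷-∣ : ∀ {p k ν} → Prime p → 1 ≤ k * p → Bound p ν → Bound p (k * p ∷ ν)
bound-∷-∣ {zero} ()
bound-∷-∣ {suc q} {zero} _ ()
bound-∷-∣ {p@(suc q)} {k@(suc j)} {ν} _ 1≤x bound =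
  bound-extend p {a = a} {b = b} {F₀ = n !} {F₁ = (x + n) !} {P₀ = p ^ (n ∸ 1)} zμ-eq (z-∷ ν 1≤x) bound
    (p^[kp+n∸1]-absorb p k n {a} {n !} {(x + n) !} {b} a*n!*p^k≤[x+n]!*b)
  where
  n = sum ν
  instance
    p^n≢0 : NonZero (p ^ (n ∸ 1))
    p^n≢0 = m^n≢0 p (n ∸ 1)
  x = k * p
  μ = powerType p ν
  m = mult k μ
  a = k ^ p * risingFactorial (suc m) p
  b = x * suc (mult x ν)
  zμ-eq : z (powerType p (x ∷ ν)) ≡ a * z μ
  zμ-eq = trans (cong (λ l → z (l ++ μ)) (powerTypeOfCycle-∣ {p} (divides k refl)))
                (trans (cong (λ i → z (replicate p i ++ μ)) (m*n/n≡m k p)) (z-replicate-++ p μ (s≤s z≤n)))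
  km≤n : k * m ≤ n
  km≤n = ≤-trans (*-mult≤sum k μ) (sum-powerType≤ p ν)
  p≤1+n+qk : p ≤ suc (n + q * k)
  p≤1+n+qk = s≤s (≤-trans (m≤m*n q k) (m≤n+m (q * k) n))
  p≤b : p ≤ b
  p≤b = ≤-trans (m≤n*m p k) (m≤m*n x (suc (mult x ν)))
  regroup : ∀ A F P Q → A * F * (P * Q) ≡ A * F * Q * P
  regroup = solve-∀
  a*n!*p^k≤[x+n]!*b : a * n ! * p ^ k ≤ (x + n) ! * b
  a*n!*p^k≤[x+n]!*b = begin
    a * n ! * p ^ k           ≡⟨ regroup a (n !) p (p ^ j) ⟩
    a * n ! * p ^ j * p       ≤⟨ *-mono-≤ (risingFactorial-bound-suc j q m n p km≤n p≤1+n+qk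
                                             (risingFactorial-bound j q m n km≤n)) p≤b ⟩
    (n + p * k) ! * b         ≡⟨ cong (λ s → s ! * b) (trans (+-comm n (p * k)) (cong (_+ n) (*-comm p k))) ⟩
    (x + n) ! * b             ∎
    where open ≤-Reasoning

bound-sorted : ∀ {p ν} → Prime p → AllPairs _≥_ ν → All (1 ≤_) ν → Bound p ν
bound-sorted {p} {[]}    _       _                 _            = bound-[] p
bound-sorted {p} {x ∷ ν} p-prime (x≥ν ∷ ν-sorted) (1≤x ∷ ν-pos) with p ∣? x
... | no p∤x               = bound-∷-∤ p-prime p∤x 1≤x x≥ν (bound-sorted p-prime ν-sorted ν-pos)
... | yes (divides k refl) = bound-∷-∣ {k = k} {ν} p-prime 1≤x (bound-sorted p-prime ν-sorted ν-pos)

bound : ∀ {p ν} → Prime p → All (1 ≤_) ν → Bound p ν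
bound {p} {ν} p-prime ν-pos = bound-↭ {p} (sort-↭ ν)
  (bound-sorted p-prime (Linked⇒AllPairs (λ y≤x z≤y → ≤-trans z≤y y≤x) (sort-↗ ν))
                        (All-resp-↭ (↭-sym (sort-↭ ν)) ν-pos))

-- The bound also holds for n = 0.
proposition3p1 : (p n : ℕ) → Prime p → 1 ≤ n → (ν : List ℕ) → IsPartition n ν →
    z (powerType p ν) ^ p * p ^ (n ∸ 1) ≤ (n ! * z ν) ^ p
proposition3p1 p n p-prime _ ν record { parts-pos = ν-pos ; parts-sum = refl } = bound p-prime ν-pos
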